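{- Let $\alpha=(\alpha_1,\dots,\alpha_\ell)$ be a strong composition. If $\alpha$ has no inversions, then $\mathrm{QKT}(\alpha)$ consists only of the basic tableau of content $\alpha$. If $\alpha$ has at least one inversion, let $i$ be the smallest index with $\alpha_i<\alpha_{i+1}$, let $\hat\alpha=(\alpha_1,\dots,\alpha_{i-1},\alpha_{i+1},\alpha_i,\alpha_{i+2},\dots,\alpha_\ell)$, and for each $\hat T\in\mathrm{QKT}(\hat\alpha)$ define the set $S(\hat T)$ as follows: let $T_0$ be obtained from $\hat T$ by changing, in every column $c\ge \alpha_i+1$, every entry $i$ into $i+1$ and every entry $i+1$ into $i$; put $T_0$ in $S(\hat T)$; then for each $k=\alpha_i+1,\dots,\alpha_{i+1}$, if the cell in row $i+1$ and column $k$ of $T_0$ is empty and the cell in row $i$ and column $k$ of $T_0$ contains $i+1$, let $T_k$ be obtained from $T_0$ by swapping the cells (with their contents, or emptiness) of row $i$ and row $i+1$ in each of the columns $\alpha_i+1,\dots,k$, and put $T_k$ in $S(\hat T)$. Then $$\mathrm{QKT}(\alpha)=\bigcup_{\hat T\in\mathrm{QKT}(\hat\alpha)}S(\hat T).$$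
   Context: A weak composition $a=(a_1,\dots,a_\ell)$ is a finite sequence of nonnegative integers; a strong composition is one whose parts are all positive. An inversion of a strong composition $\alpha$ is a pair $(i,j)$ with $i<j$ and $\alpha_i<\alpha_j$. A diagram is a finite set of cells $(r,c)$ with $r,c$ positive integers, the cell $(r,c)$ lying in row $r$ (counted from the bottom) and column $c$ (counted from the left). A Kohnert tableau of content $a$ is a diagram whose cells are filled with positive integers, with exactly $a_i$ cells containing $i$ for each $i$, such that: (i) for each $i$ there is exactly one $i$ in each of the columns $1,\dots,a_i$; (ii) every entry in row $r$ is at least $r$; (iii) for each $i$, the cells containing $i$ weakly descend from left to right; (iv) if $i<j$ appear in the same column with $i$ above $j$, then there is an $i$ in the column immediately to the right of the cell containing that $j$, in a row strictly above it. It is quasi-Yamanouchi if moreover (v) for each nonempty row $r$, either row $r$ contains an entry equal to $r$, or some cell of row $r+1$ lies weakly to the right of some cell of row $r$. $\mathrm{QKT}(a)$ denotes the set of quasi-Yamanouchi Kohnert tableaux of content $a$. The basic tableau of content $a$ has, for each $i$, the cells $(i,1),\dots,(i,a_i)$ filled with $i$ and no other cells. -}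

module Defs where

open import Data.Nat using (ℕ; zero; suc; _≤_; _<_; _<ᵇ_; _≡ᵇ_)
open import Data.Bool using (Bool; true; false; if_then_else_; _∧_)
open import Data.List using (List; []; _∷_; length)
open import Data.List.Relation.Unary.All using (All)
open import Data.Maybe using (Maybe; just; nothing; map)
open import Data.Product using (Σ; ∃; _×_)
open import Data.Sum using (_⊎_)
open import Relation.Binary.PropositionalEquality using (_≡_; _≢_)
open import Relation.Nullary using (¬_)

-- Compositions: lists of naturals, parts indexed from 1.
-- part a i = a_i for 1 ≤ i ≤ length a, and 0 otherwise.

lk : List ℕ → ℕ → ℕ
lk []       _       = 0
lk (x ∷ xs) zero    = x
lk (x ∷ xs) (suc i) = lk xs i

part : List ℕ → ℕ → ℕ
part a zero    = 0
part a (suc i) = lk a i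

Strong : List ℕ → Set
Strong α = All (λ x → 1 ≤ x) α

HasInversion : List ℕ → Set
HasInversion α = ∃ λ i → ∃ λ j →
  1 ≤ i × i < j × j ≤ length α × part α i < part α j

IsFirstAscent : List ℕ → ℕ → Set
IsFirstAscent α i =
  1 ≤ i × suc i ≤ length α × part α i < part α (suc i) ×
  (∀ j → 1 ≤ j → j < i → ¬ (part α j < part α (suc j)))

swap0 : ℕ → List ℕ → List ℕ
swap0 zero    (x ∷ y ∷ xs) = y ∷ x ∷ xs
swap0 (suc n) (x ∷ xs)     = x ∷ swap0 n xs
swap0 _       xs           = xs

-- α̂ : swap the (1-indexed) parts i and i+1
swapParts : ℕ → List ℕ → List ℕ
swapParts zero    xs = xs
swapParts (suc n) xs = swap0 n xs

-- Filled diagrams: T r c = just v means cell (row r, column c) is in the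
-- diagram and filled with v; nothing means the cell is absent.
-- Rows/columns are positive integers; row/column 0 must be empty.

Filling : Set
Filling = ℕ → ℕ → Maybe ℕ

IsCell : Filling → ℕ → ℕ → Set
IsCell T r c = ∃ λ v → T r c ≡ just v

_≐_ : Filling → Filling → Set
T ≐ U = ∀ r c → T r c ≡ U r c

record KohnertTableau (a : List ℕ) (T : Filling) : Set where
  field
    row0-empty : ∀ c → T 0 c ≡ nothing
    col0-empty : ∀ r → T r 0 ≡ nothing
    entries-pos : ∀ r c v → T r c ≡ just v → 1 ≤ v
    -- (i) together with "exactly a_i cells contain i": exactly one i in each
    -- column 1..a_i, and no i in any other column
    cond-i-in  : ∀ i c → 1 ≤ c → c ≤ part a i →
                 ∃ λ r → T r c ≡ just i × (∀ r' → T r' c ≡ just i → r' ≡ r)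
    cond-i-out : ∀ i c → ¬ (1 ≤ c × c ≤ part a i) → ∀ r → T r c ≢ just i
    cond-ii  : ∀ r c v → T r c ≡ just v → r ≤ v
    cond-iii : ∀ i r c r' c' → T r c ≡ just i → T r' c' ≡ just i → c < c' → r' ≤ r
    cond-iv  : ∀ i j c r r' → T r c ≡ just i → T r' c ≡ just j → i < j → r' < r →
               ∃ λ r'' → r' < r'' × T r'' (suc c) ≡ just i

QuasiYamanouchi : Filling → Set
QuasiYamanouchi T = ∀ r → (∃ λ c → IsCell T r c) →
  (∃ λ c → T r c ≡ just r) ⊎
  (∃ λ c → ∃ λ c' → c ≤ c' × IsCell T r c × IsCell T (suc r) c')

QKT : List ℕ → Filling → Set
QKT a T = KohnertTableau a T × QuasiYamanouchi T

basic : List ℕ → Filling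
basic a r c = if (0 <ᵇ c) ∧ ((c <ᵇ part a r) Data.Bool.∨ (c ≡ᵇ part a r))
              then just r else nothing

swapVal : ℕ → ℕ → ℕ
swapVal i v = if v ≡ᵇ i then suc i else (if v ≡ᵇ suc i then i else v)

T0 : List ℕ → ℕ → Filling → Filling
T0 α i T̂ r c = if part α i <ᵇ c then map (swapVal i) (T̂ r c) else T̂ r c

Tk : List ℕ → ℕ → Filling → ℕ → Filling
Tk α i T̂ k r c =
  if (part α i <ᵇ c) ∧ ((c <ᵇ k) Data.Bool.∨ (c ≡ᵇ k))
  then (if r ≡ᵇ i then T0 α i T̂ (suc i) c
        else if r ≡ᵇ suc i then T0 α i T̂ i c
        else T0 α i T̂ r c)
  else T0 α i T̂ r c

InS : List ℕ → ℕ → Filling → Filling → Set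
InS α i T̂ T =
  (T ≐ T0 α i T̂) ⊎
  (∃ λ k → part α i < k × k ≤ part α (suc i) ×
           T0 α i T̂ (suc i) k ≡ nothing × T0 α i T̂ i k ≡ just (suc i) ×
           (T ≐ Tk α i T̂ k))

module Submission where

-- Without inversions the parts weakly decrease, and column by column every entry is forced into its
-- basic position, so the basic tableau is the only Kohnert tableau. At the first ascent i all earlier
-- parts are at least α_i, so rows 1, …, i+1 are basic up to column α_i in every tableau involved.
-- A tableau T ∈ QKT(α) and T̂ ∈ QKT(α̂) then correspond by exchanging the values i, i+1 in the columns
-- beyond α_i and, in the columns α_i < c ≤ k, also the rows i and i+1, where k is the last column in
-- which row i+1 of T holds an i+1. Both exchanges are involutions; conditions (i), (ii) and (v) pass
-- through them directly, and (iii) and (iv) survive because T has no i+1 in row i+1 beyond column k,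
-- which on the side of T̂ is the empty cell (i+1, k) required in S(T̂).

open import Defs
open import Data.Bool using (Bool; true; false; if_then_else_; _∧_; _∨_)
open import Data.Bool.Properties using (∧-zeroʳ; ∨-zeroʳ)
open import Data.Empty using (⊥; ⊥-elim)
open import Data.List using (List; []; _∷_; length)
open import Data.List.Relation.Unary.All using (_∷_)
open import Data.Maybe as Maybe using (Maybe; just; nothing)
open import Data.Maybe.Properties using (just-injective; map-id; ≡-dec)
open import Data.Nat using (ℕ; zero; suc; _≤_; _<_; _<ᵇ_; _≡ᵇ_; z≤n; s≤s)
open import Data.Nat.Properties
open import Data.Product using (∃; _×_; _,_; proj₁; proj₂; uncurry)
open import Data.Sum using (_⊎_; inj₁; inj₂)
open import Function.Base using (_∘′_)
open import Function.Bundles using (_⇔_; mk⇔)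
open import Relation.Binary.PropositionalEquality
open import Relation.Nullary using (¬_; yes; no; does)
open import Relation.Unary using (Decidable)
open import Relation.Nullary.Decidable using (dec-true; dec-false; _×-dec_)

<ᵇ-true : ∀ {m n} → m < n → (m <ᵇ n) ≡ true
<ᵇ-true {m} {n} = dec-true (m <? n)

<ᵇ-false : ∀ {m n} → ¬ m < n → (m <ᵇ n) ≡ false
<ᵇ-false {m} {n} = dec-false (m <? n)

≡ᵇ-true : ∀ {m n} → m ≡ n → (m ≡ᵇ n) ≡ true
≡ᵇ-true {m} {n} = dec-true (m ≟ n)

≡ᵇ-false : ∀ {m n} → m ≢ n → (m ≡ᵇ n) ≡ false
≡ᵇ-false {m} {n} = dec-false (m ≟ n)

just≢nothing : ∀ {v : ℕ} → just v ≢ nothing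
just≢nothing ()

n≢1+n : ∀ {n} → n ≢ suc n
n≢1+n {n} = <⇒≢ (n<1+n n)

map-just⁻ : ∀ {f : ℕ → ℕ} {m v} → Maybe.map f m ≡ just v → ∃ λ w → m ≡ just w × f w ≡ v
map-just⁻ {m = just w} e = w , refl , just-injective e

map-nothing⁻ : ∀ {f : ℕ → ℕ} {m} → Maybe.map f m ≡ nothing → m ≡ nothing
map-nothing⁻ {m = nothing} _ = refl

map-involutive : ∀ {f : ℕ → ℕ} → (∀ v → f (f v) ≡ v) → ∀ m → Maybe.map f (Maybe.map f m) ≡ m
map-involutive f-inv (just v) = cong just (f-inv v)
map-involutive f-inv nothing  = refl

swapVal-i : ∀ i → swapVal i i ≡ suc i
swapVal-i i rewrite ≡ᵇ-true {i} refl = refl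

swapVal-suc-i : ∀ i → swapVal i (suc i) ≡ i
swapVal-suc-i i rewrite ≡ᵇ-false (≢-sym (n≢1+n {i})) | ≡ᵇ-true {i} refl = refl

swapVal-other : ∀ i {v} → v ≢ i → v ≢ suc i → swapVal i v ≡ v
swapVal-other i v≢i v≢1+i rewrite ≡ᵇ-false v≢i | ≡ᵇ-false v≢1+i = refl

swapVal-involutive : ∀ i v → swapVal i (swapVal i v) ≡ v
swapVal-involutive i v with v ≟ i | v ≟ suc i
... | yes refl | _        rewrite swapVal-i i     = swapVal-suc-i i
... | no _     | yes refl rewrite swapVal-suc-i i = swapVal-i i
... | no v≢i   | no v≢1+i rewrite swapVal-other i v≢i v≢1+i = swapVal-other i v≢i v≢1+i

swapVal≤1+ : ∀ i v → swapVal i v ≤ suc v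
swapVal≤1+ i v with v ≟ i | v ≟ suc i
... | yes refl | _        rewrite swapVal-i i     = ≤-refl
... | no _     | yes refl rewrite swapVal-suc-i i = m≤n⇒m≤1+n (n≤1+n i)
... | no v≢i   | no v≢1+i rewrite swapVal-other i v≢i v≢1+i = n≤1+n v

swapIf : ℕ → Bool → ℕ → ℕ
swapIf i b v = if b then swapVal i v else v

swapIf-other : ∀ i b {v} → v ≢ i → v ≢ suc i → swapIf i b v ≡ v
swapIf-other i true  v≢i v≢1+i = swapVal-other i v≢i v≢1+i
swapIf-other i false _   _     = refl

swapIf-involutive : ∀ i b v → swapIf i b (swapIf i b v) ≡ v
swapIf-involutive i true  v = swapVal-involutive i v
swapIf-involutive i false v = refl

swapIf≤1+ : ∀ i b v → swapIf i b v ≤ suc v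
swapIf≤1+ i true  v = swapVal≤1+ i v
swapIf≤1+ i false v = n≤1+n v

lk-swap0-at : ∀ n (xs : List ℕ) → suc (suc n) ≤ length xs → lk (swap0 n xs) n ≡ lk xs (suc n)
lk-swap0-at zero    (x ∷ y ∷ xs) _       = refl
lk-swap0-at zero    (x ∷ [])     (s≤s ())
lk-swap0-at (suc n) (x ∷ xs)     (s≤s h) = lk-swap0-at n xs h

lk-swap0-at-suc : ∀ n (xs : List ℕ) → suc (suc n) ≤ length xs → lk (swap0 n xs) (suc n) ≡ lk xs n
lk-swap0-at-suc zero    (x ∷ y ∷ xs) _       = refl
lk-swap0-at-suc zero    (x ∷ [])     (s≤s ())
lk-swap0-at-suc (suc n) (x ∷ xs)     (s≤s h) = lk-swap0-at-suc n xs h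

lk-swap0-other : ∀ n (xs : List ℕ) m → m ≢ n → m ≢ suc n → lk (swap0 n xs) m ≡ lk xs m
lk-swap0-other zero    []           m             _   _   = refl
lk-swap0-other zero    (x ∷ [])     m             _   _   = refl
lk-swap0-other zero    (x ∷ y ∷ xs) zero          m≢n _   = ⊥-elim (m≢n refl)
lk-swap0-other zero    (x ∷ y ∷ xs) (suc zero)    _   m≢1 = ⊥-elim (m≢1 refl)
lk-swap0-other zero    (x ∷ y ∷ xs) (suc (suc m)) _   _   = refl
lk-swap0-other (suc n) []           m             _   _   = refl
lk-swap0-other (suc n) (x ∷ xs)     zero          _   _   = refl
lk-swap0-other (suc n) (x ∷ xs)     (suc m) m≢n m≢1+n =
  lk-swap0-other n xs m (m≢n ∘′ cong suc) (m≢1+n ∘′ cong suc)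

lk-beyond-length : ∀ (xs : List ℕ) n → length xs ≤ n → lk xs n ≡ 0
lk-beyond-length []       n       _       = refl
lk-beyond-length (x ∷ xs) (suc n) (s≤s h) = lk-beyond-length xs n h

Strong⇒lk-positive : ∀ {xs : List ℕ} → Strong xs → ∀ n → n < length xs → 1 ≤ lk xs n
Strong⇒lk-positive (p ∷ _)  zero    _       = p
Strong⇒lk-positive (_ ∷ ps) (suc n) (s≤s h) = Strong⇒lk-positive ps n h

weakly-decreasing⇒≤ : ∀ (α : List ℕ) i → (∀ j → 1 ≤ j → j < i → part α (suc j) ≤ part α j) →
                      ∀ j → 1 ≤ j → j ≤ i → part α i ≤ part α j
weakly-decreasing⇒≤ α zero    _   j 1≤j j≤0 = ⊥-elim (<⇒≱ 1≤j j≤0)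
weakly-decreasing⇒≤ α (suc i) dec j 1≤j j≤1+i with j ≟ suc i
... | yes refl = ≤-refl
... | no j≢1+i = ≤-trans (dec i (≤-trans 1≤j j≤i) (n<1+n i))
                         (weakly-decreasing⇒≤ α i (λ j′ 1≤j′ j′<i → dec j′ 1≤j′ (m<n⇒m<1+n j′<i)) j 1≤j j≤i)
  where j≤i = ≤-pred (≤∧≢⇒< j≤1+i j≢1+i)

part-swapParts-i : ∀ α {i} → 1 ≤ i → suc i ≤ length α → part (swapParts i α) i ≡ part α (suc i)
part-swapParts-i α {suc n} _ = lk-swap0-at n α

part-swapParts-suc-i : ∀ α {i} → 1 ≤ i → suc i ≤ length α → part (swapParts i α) (suc i) ≡ part α i
part-swapParts-suc-i α {suc n} _ = lk-swap0-at-suc n α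

part-swapParts-other : ∀ α {i} j → 1 ≤ i → j ≢ i → j ≢ suc i → part (swapParts i α) j ≡ part α j
part-swapParts-other α {suc n} zero    _ _   _     = refl
part-swapParts-other α {suc n} (suc m) _ m≢n m≢1+n =
  lk-swap0-other n α m (m≢n ∘′ cong suc) (m≢1+n ∘′ cong suc)

Strong⇒part-positive : ∀ {α} → Strong α → ∀ {i} → 1 ≤ i → i ≤ length α → 1 ≤ part α i
Strong⇒part-positive strong {suc n} _ = Strong⇒lk-positive strong n

module LastSatisfying {P : ℕ → Set} (P? : Decidable P) where

  last : ℕ → ℕ
  last zero    = 0
  last (suc n) = if does (P? (suc n)) then suc n else last n

  last≤ : ∀ n → last n ≤ n
  last≤ zero    = z≤n
  last≤ (suc n) with P? (suc n)
  ... | yes _ = ≤-refl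
  ... | no _  = m≤n⇒m≤1+n (last≤ n)

  last-maximal : ∀ n c → last n < c → c ≤ n → ¬ P c
  last-maximal zero    c last<c c≤0 = ⊥-elim (<⇒≱ last<c c≤0)
  last-maximal (suc n) c last<c c≤1+n with P? (suc n) | c ≟ suc n
  ... | yes _ | _        = ⊥-elim (<⇒≱ last<c c≤1+n)
  ... | no ¬P | yes refl = ¬P
  ... | no _  | no c≢1+n = last-maximal n c last<c (≤-pred (≤∧≢⇒< c≤1+n c≢1+n))

  ≤last : ∀ n c → c ≤ n → P c → c ≤ last n
  ≤last n c c≤n Pc with c ≤? last n
  ... | yes c≤last = c≤last
  ... | no c≰last  = ⊥-elim (last-maximal n c (≰⇒> c≰last) c≤n Pc)

  last-zero-or-satisfies : ∀ n → last n ≡ 0 ⊎ P (last n)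
  last-zero-or-satisfies zero    = inj₁ refl
  last-zero-or-satisfies (suc n) with P? (suc n)
  ... | yes Pn = inj₂ Pn
  ... | no _   = last-zero-or-satisfies n

module KohnertFacts {A : List ℕ} {T : Filling} (K : KohnertTableau A T) where
  open KohnertTableau K

  entry-in-range : ∀ {r c v} → T r c ≡ just v → 1 ≤ c × c ≤ part A v
  entry-in-range {r} {c} {v} e with (1 ≤? c) ×-dec (c ≤? part A v)
  ... | yes in-range = in-range
  ... | no out       = ⊥-elim (cond-i-out v c out r e)

  entry-row-unique : ∀ {r r′ c v} → T r c ≡ just v → T r′ c ≡ just v → r ≡ r′
  entry-row-unique {r} {r′} {c} {v} e e′ with entry-in-range e
  ... | 1≤c , c≤a with cond-i-in v c 1≤c c≤a
  ... | _ , _ , unique = trans (unique r e) (sym (unique r′ e′))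

  basic-region : ∀ r c → 1 ≤ r → 1 ≤ c → (∀ j → 1 ≤ j → j ≤ r → c ≤ part A j) → T r c ≡ just r
  basic-region r = go r r ≤-refl
    where
    go : ∀ n r → r ≤ n → ∀ c → 1 ≤ r → 1 ≤ c → (∀ j → 1 ≤ j → j ≤ r → c ≤ part A j) →
         T r c ≡ just r
    go zero    r r≤0 c 1≤r _ _ = ⊥-elim (<⇒≱ 1≤r r≤0)
    go (suc n) r r≤n c 1≤r 1≤c c≤parts with cond-i-in r c 1≤c (c≤parts r 1≤r ≤-refl)
    ... | s , e , _ with s ≟ r
    ... | yes refl = e
    ... | no s≢r with s
    ... | zero   = ⊥-elim (just≢nothing (trans (sym e) (row0-empty c)))
    ... | suc s′ = ⊥-elim (s≢r (just-injective (trans (sym below) e)))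
      where
      s<r : suc s′ < r
      s<r = ≤∧≢⇒< (cond-ii (suc s′) c r e) s≢r
      below : T (suc s′) c ≡ just (suc s′)
      below = go n (suc s′) (≤-pred (≤-trans s<r r≤n)) c (s≤s z≤n) 1≤c
                 (λ j 1≤j j≤s → c≤parts j 1≤j (≤-trans j≤s (<⇒≤ s<r)))

  self-entry-leftward : ∀ {v k c} → T v k ≡ just v → 1 ≤ c → c ≤ k → T v c ≡ just v
  self-entry-leftward {v} {k} {c} e 1≤c c≤k with c ≟ k
  ... | yes refl = e
  ... | no c≢k with cond-i-in v c 1≤c (≤-trans c≤k (proj₂ (entry-in-range e)))
  ... | r , e′ , _ = subst (λ t → T t c ≡ just v) r≡v e′
    where
    r≡v : r ≡ v
    r≡v = ≤-antisym (cond-ii r c v e′) (cond-iii v r c v k e′ e (≤∧≢⇒< c≤k c≢k))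

quasiYamanouchi-from-agreement :
  ∀ m (T U : Filling) → (∀ c → T 0 c ≡ nothing) → (∀ r → 1 ≤ r → r ≤ m → T r 1 ≡ just r) →
  (∀ r c → m < r → T r c ≡ U r c) → QuasiYamanouchi U → QuasiYamanouchi T
quasiYamanouchi-from-agreement m T U row0 low high QU zero (c , v , e) =
  ⊥-elim (just≢nothing (trans (sym e) (row0 c)))
quasiYamanouchi-from-agreement m T U row0 low high QU (suc r) (c , v , e) with suc r ≤? m
... | yes r<m = inj₁ (1 , low (suc r) (s≤s z≤n) r<m)
... | no r≮m with QU (suc r) (c , v , trans (sym (high _ c m<r)) e)
  where m<r = ≰⇒> r≮m
... | inj₁ (c′ , e′) = inj₁ (c′ , trans (high _ c′ (≰⇒> r≮m)) e′)
... | inj₂ (c₁ , c₂ , c₁≤c₂ , (v₁ , e₁) , (v₂ , e₂)) =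
  inj₂ (c₁ , c₂ , c₁≤c₂ , (v₁ , trans (high _ c₁ (≰⇒> r≮m)) e₁) ,
        (v₂ , trans (high _ c₂ (m≤n⇒m≤1+n (≰⇒> r≮m))) e₂))

-- Compositions without inversions

module _ (α : List ℕ) {T : Filling} (T≐basic : T ≐ basic α) where

  ≐basic-inside : ∀ {r c} → 1 ≤ c → c ≤ part α r → T r c ≡ just r
  ≐basic-inside {r} {c} 1≤c c≤α
    rewrite T≐basic r c | <ᵇ-true {0} {c} 1≤c with c ≟ part α r
  ... | yes refl rewrite ≡ᵇ-true {c} refl | ∨-zeroʳ (c <ᵇ c) = refl
  ... | no c≢α   rewrite <ᵇ-true (≤∧≢⇒< c≤α c≢α) = refl

  ≐basic-outside : ∀ {r c} → ¬ (1 ≤ c × c ≤ part α r) → T r c ≡ nothing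
  ≐basic-outside {r} {c} out rewrite T≐basic r c with 1 ≤? c
  ... | no 1≰c rewrite <ᵇ-false {0} {c} 1≰c = refl
  ... | yes 1≤c
    rewrite <ᵇ-true {0} {c} 1≤c | <ᵇ-false (λ c<α → out (1≤c , <⇒≤ c<α))
          | ≡ᵇ-false (λ c≡α → out (1≤c , ≤-reflexive c≡α)) = refl

  ≐basic-entry : ∀ {r c v} → T r c ≡ just v → v ≡ r × 1 ≤ c × c ≤ part α r
  ≐basic-entry {r} {c} {v} e with (1 ≤? c) ×-dec (c ≤? part α r)
  ... | yes (1≤c , c≤α) = just-injective (trans (sym e) (≐basic-inside 1≤c c≤α)) , 1≤c , c≤α
  ... | no out          = ⊥-elim (just≢nothing (trans (sym e) (≐basic-outside out)))

  ≐basic⇒QKT : QKT α T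
  ≐basic⇒QKT = record
    { row0-empty  = λ c → ≐basic-outside (λ (1≤c , c≤0) → <⇒≱ 1≤c c≤0)
    ; col0-empty  = λ r → ≐basic-outside (λ (1≤0 , _) → <⇒≱ 1≤0 z≤n)
    ; entries-pos = λ r c v e → positive (≐basic-entry e)
    ; cond-i-in   = λ v c 1≤c c≤α → v , ≐basic-inside 1≤c c≤α , λ r e → sym (proj₁ (≐basic-entry e))
    ; cond-i-out  = λ v c out r e → out (in-range (≐basic-entry e))
    ; cond-ii     = λ r c v e → ≤-reflexive (sym (proj₁ (≐basic-entry e)))
    ; cond-iii    = λ v r c r′ c′ e e′ _ →
                      ≤-reflexive (trans (sym (proj₁ (≐basic-entry e′))) (proj₁ (≐basic-entry e)))
    ; cond-iv     = λ x y c r r′ ex ey x<y r′<r →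
                      ⊥-elim (<-asym (subst₂ _<_ (proj₁ (≐basic-entry ex)) (proj₁ (≐basic-entry ey)) x<y) r′<r)
    } , λ r (c , v , e) → inj₁ (c , subst (λ t → T r c ≡ just t) (proj₁ (≐basic-entry e)) e)
    where
    positive : ∀ {r c v} → v ≡ r × 1 ≤ c × c ≤ part α r → 1 ≤ v
    positive {zero}  (refl , 1≤c , c≤0) = ⊥-elim (<⇒≱ 1≤c c≤0)
    positive {suc r} (refl , _ , _)     = s≤s z≤n
    in-range : ∀ {r c v} → v ≡ r × 1 ≤ c × c ≤ part α r → 1 ≤ c × c ≤ part α v
    in-range (refl , 1≤c , c≤α) = 1≤c , c≤α

module NoInversion (α : List ℕ) (no-inversion : ¬ HasInversion α) where

  parts-decreasing : ∀ r j → 1 ≤ j → j ≤ r → part α r ≤ part α j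
  parts-decreasing r = weakly-decreasing⇒≤ α r (λ j 1≤j _ → step j 1≤j)
    where
    step : ∀ j → 1 ≤ j → part α (suc j) ≤ part α j
    step j 1≤j with suc j ≤? length α
    ... | yes j<ℓ = ≮⇒≥ (λ ascent → no-inversion (j , suc j , 1≤j , n<1+n j , j<ℓ , ascent))
    ... | no j≮ℓ  = subst (_≤ part α j) (sym (lk-beyond-length α j (≤-pred (≰⇒> j≮ℓ)))) z≤n

  module _ {T : Filling} (K : KohnertTableau α T) where
    open KohnertFacts K

    Kohnert-basic-inside : ∀ {r c} → 1 ≤ c → c ≤ part α r → T r c ≡ just r
    Kohnert-basic-inside {zero}  1≤c c≤0 = ⊥-elim (<⇒≱ 1≤c c≤0)
    Kohnert-basic-inside {suc r} 1≤c c≤α =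
      basic-region (suc r) _ (s≤s z≤n) 1≤c (λ j 1≤j j≤r → ≤-trans c≤α (parts-decreasing (suc r) j 1≤j j≤r))

    Kohnert-basic-outside : ∀ {r c} → ¬ (1 ≤ c × c ≤ part α r) → T r c ≡ nothing
    Kohnert-basic-outside {r} {c} out with T r c in e
    ... | nothing = refl
    ... | just v with entry-in-range e
    ... | 1≤c , c≤α = ⊥-elim (out (1≤c , subst (λ t → c ≤ part α t) (sym r≡v) c≤α))
      where r≡v = entry-row-unique e (Kohnert-basic-inside 1≤c c≤α)

    Kohnert⇒≐basic : T ≐ basic α
    Kohnert⇒≐basic r c with (1 ≤? c) ×-dec (c ≤? part α r)
    ... | yes (1≤c , c≤α) =
          trans (Kohnert-basic-inside 1≤c c≤α) (sym (≐basic-inside α (λ _ _ → refl) 1≤c c≤α))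
    ... | no out          = trans (Kohnert-basic-outside out) (sym (≐basic-outside α (λ _ _ → refl) out))

-- The exchange at the first ascent

module Exchange
  (α β : List ℕ) (i : ℕ) (1≤i : 1 ≤ i)
  (1≤a : 1 ≤ part α i) (a<b : part α i < part α (suc i))
  (a≤α-before : ∀ j → 1 ≤ j → j ≤ i → part α i ≤ part α j)
  (β-at-i : part β i ≡ part α (suc i)) (β-at-suc-i : part β (suc i) ≡ part α i)
  (β-other : ∀ j → j ≢ i → j ≢ suc i → part β j ≡ part α j) where

  a b : ℕ
  a = part α i
  b = part α (suc i)

  a≤α-upto : ∀ j → 1 ≤ j → j ≤ suc i → a ≤ part α j
  a≤α-upto j 1≤j j≤1+i with j ≟ suc i
  ... | yes refl = <⇒≤ a<b
  ... | no j≢1+i = a≤α-before j 1≤j (≤-pred (≤∧≢⇒< j≤1+i j≢1+i))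

  a≤β-upto : ∀ j → 1 ≤ j → j ≤ suc i → a ≤ part β j
  a≤β-upto j 1≤j j≤1+i with j ≟ i | j ≟ suc i
  ... | yes refl | _        = subst (a ≤_) (sym β-at-i) (<⇒≤ a<b)
  ... | no _     | yes refl = ≤-reflexive (sym β-at-suc-i)
  ... | no j≢i   | no j≢1+i =
        subst (a ≤_) (sym (β-other j j≢i j≢1+i)) (a≤α-before j 1≤j (≤-pred (≤∧≢⇒< j≤1+i j≢1+i)))

  π : ℕ → ℕ → ℕ
  π c = swapIf i (a <ᵇ c)

  π-left : ∀ {c v} → c ≤ a → π c v ≡ v
  π-left {c} {v} c≤a = cong (λ t → swapIf i t v) (<ᵇ-false (≤⇒≯ c≤a))

  π-right : ∀ {c v} → a < c → π c v ≡ swapVal i v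
  π-right {c} {v} a<c = cong (λ t → swapIf i t v) (<ᵇ-true a<c)

  π-right-i : ∀ {c} → a < c → π c i ≡ suc i
  π-right-i a<c = trans (π-right a<c) (swapVal-i i)

  π-right-suc-i : ∀ {c} → a < c → π c (suc i) ≡ i
  π-right-suc-i a<c = trans (π-right a<c) (swapVal-suc-i i)

  π-other : ∀ {c v} → v ≢ i → v ≢ suc i → π c v ≡ v
  π-other {c} = swapIf-other i (a <ᵇ c)

  π-involutive : ∀ {c v} → π c (π c v) ≡ v
  π-involutive {c} {v} = swapIf-involutive i (a <ᵇ c) v

  π-right-const : ∀ {c c′ v} → a < c → a < c′ → π c v ≡ π c′ v
  π-right-const a<c a<c′ = trans (π-right a<c) (sym (π-right a<c′))

  π-<-avoiding-i : ∀ {c x y} → a < c → x ≢ i → y ≢ i → x < y → π c x < π c y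
  π-<-avoiding-i {c} {x} {y} a<c x≢i y≢i x<y with x ≟ suc i | y ≟ suc i
  ... | yes refl | yes refl = ⊥-elim (<-irrefl refl x<y)
  ... | yes refl | no y≢1+i rewrite π-right-suc-i {c} a<c | π-other {c} y≢i y≢1+i = <-trans (n<1+n i) x<y
  ... | no x≢1+i | yes refl rewrite π-right-suc-i {c} a<c | π-other {c} x≢i x≢1+i = ≤∧≢⇒< (≤-pred x<y) x≢i
  ... | no x≢1+i | no y≢1+i rewrite π-other {c} x≢i x≢1+i | π-other {c} y≢i y≢1+i = x<y

  π-<-avoiding-suc-i : ∀ {c x y} → a < c → x ≢ suc i → y ≢ suc i → x < y → π c x < π c y
  π-<-avoiding-suc-i {c} {x} {y} a<c x≢1+i y≢1+i x<y with x ≟ i | y ≟ i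
  ... | yes refl | yes refl = ⊥-elim (<-irrefl refl x<y)
  ... | yes refl | no y≢i rewrite π-right-i {c} a<c | π-other {c} y≢i y≢1+i = ≤∧≢⇒< x<y (≢-sym y≢1+i)
  ... | no x≢i   | yes refl rewrite π-right-i {c} a<c | π-other {c} x≢i x≢1+i = ≤-trans x<y (n≤1+n i)
  ... | no x≢i   | no y≢i rewrite π-other {c} x≢i x≢1+i | π-other {c} y≢i y≢1+i = x<y

  α-column⇒β-column : ∀ {c v} → c ≤ part α v → c ≤ part β (π c v)
  α-column⇒β-column {c} {v} c≤α with v ≟ i | v ≟ suc i | c ≤? a
  ... | yes refl | _        | yes c≤a rewrite π-left {c} {i} c≤a | β-at-i = ≤-trans c≤a (<⇒≤ a<b)
  ... | yes refl | _        | no c≰a  = ⊥-elim (c≰a c≤α)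
  ... | no _     | yes refl | yes c≤a rewrite π-left {c} {suc i} c≤a | β-at-suc-i = c≤a
  ... | no _     | yes refl | no c≰a  rewrite π-right-suc-i {c} (≰⇒> c≰a) | β-at-i = c≤α
  ... | no v≢i   | no v≢1+i | _ rewrite π-other {c} v≢i v≢1+i | β-other v v≢i v≢1+i = c≤α

  β-column⇒α-column : ∀ {c v} → c ≤ part β (π c v) → c ≤ part α v
  β-column⇒α-column {c} {v} c≤β with v ≟ i | v ≟ suc i | c ≤? a
  ... | yes refl | _        | yes c≤a = c≤a
  ... | yes refl | _        | no c≰a rewrite π-right-i {c} (≰⇒> c≰a) | β-at-suc-i = ⊥-elim (c≰a c≤β)
  ... | no _     | yes refl | yes c≤a = ≤-trans c≤a (<⇒≤ a<b)
  ... | no _     | yes refl | no c≰a rewrite π-right-suc-i {c} (≰⇒> c≰a) | β-at-i = c≤β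
  ... | no v≢i   | no v≢1+i | _ rewrite π-other {c} v≢i v≢1+i | β-other v v≢i v≢1+i = c≤β

  β-column⇒α-column′ : ∀ {c v} → c ≤ part β v → c ≤ part α (π c v)
  β-column⇒α-column′ {c} {v} c≤β =
    β-column⇒α-column {c} {π c v} (subst (λ t → c ≤ part β t) (sym (π-involutive {c} {v})) c≤β)

  α-column⇒β-column′ : ∀ {c v} → c ≤ part α (π c v) → c ≤ part β v
  α-column⇒β-column′ {c} {v} c≤α =
    subst (λ t → c ≤ part β t) (π-involutive {c} {v}) (α-column⇒β-column {c} {π c v} c≤α)

  T0-exchange : ∀ W r c → T0 α i W r c ≡ Maybe.map (π c) (W r c)
  T0-exchange W r c with a <ᵇ c
  ... | true  = refl
  ... | false = sym (map-id (W r c))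

  module Window (k : ℕ) (a≤k : a ≤ k) where

    data ColumnRegion (c : ℕ) : Set where
      left   : c ≤ a → ColumnRegion c
      window : a < c → c ≤ k → ColumnRegion c
      right  : k < c → ColumnRegion c

    region : ∀ c → ColumnRegion c
    region c with c ≤? a | c ≤? k
    ... | yes c≤a | _       = left c≤a
    ... | no c≰a  | yes c≤k = window (≰⇒> c≰a) c≤k
    ... | no _    | no c≰k  = right (≰⇒> c≰k)

    inWindow : ℕ → Bool
    inWindow c = (a <ᵇ c) ∧ ((c <ᵇ k) ∨ (c ≡ᵇ k))

    inWindow-true : ∀ {c} → a < c → c ≤ k → inWindow c ≡ true
    inWindow-true {c} a<c c≤k rewrite <ᵇ-true a<c with c ≟ k
    ... | yes refl rewrite ≡ᵇ-true {c} refl = ∨-zeroʳ (c <ᵇ c)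
    ... | no c≢k   rewrite <ᵇ-true (≤∧≢⇒< c≤k c≢k) = refl

    inWindow-left : ∀ {c} → c ≤ a → inWindow c ≡ false
    inWindow-left c≤a rewrite <ᵇ-false (≤⇒≯ c≤a) = refl

    inWindow-right : ∀ {c} → k < c → inWindow c ≡ false
    inWindow-right {c} k<c rewrite <ᵇ-false (<⇒≯ k<c) | ≡ᵇ-false (>⇒≢ k<c) = ∧-zeroʳ (a <ᵇ c)

    ρ : ℕ → ℕ → ℕ
    ρ c = swapIf i (inWindow c)

    ρ-outside : ∀ {c r} → inWindow c ≡ false → ρ c r ≡ r
    ρ-outside {c} {r} e = cong (λ t → swapIf i t r) e

    ρ-left : ∀ {c r} → c ≤ a → ρ c r ≡ r
    ρ-left c≤a = ρ-outside (inWindow-left c≤a)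

    ρ-right : ∀ {c r} → k < c → ρ c r ≡ r
    ρ-right k<c = ρ-outside (inWindow-right k<c)

    ρ-window-i : ∀ {c} → a < c → c ≤ k → ρ c i ≡ suc i
    ρ-window-i a<c c≤k = trans (cong (λ t → swapIf i t i) (inWindow-true a<c c≤k)) (swapVal-i i)

    ρ-window-suc-i : ∀ {c} → a < c → c ≤ k → ρ c (suc i) ≡ i
    ρ-window-suc-i a<c c≤k = trans (cong (λ t → swapIf i t (suc i)) (inWindow-true a<c c≤k)) (swapVal-suc-i i)

    ρ-other : ∀ {c r} → r ≢ i → r ≢ suc i → ρ c r ≡ r
    ρ-other {c} = swapIf-other i (inWindow c)

    ρ-involutive : ∀ {c r} → ρ c (ρ c r) ≡ r
    ρ-involutive {c} {r} = swapIf-involutive i (inWindow c) r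

    ρ-zero : ∀ {c} → ρ c 0 ≡ 0
    ρ-zero {c} = ρ-other {c} (<⇒≢ 1≤i) λ ()

    ρ≤1+ : ∀ {c r} → ρ c r ≤ suc r
    ρ≤1+ {c} {r} = swapIf≤1+ i (inWindow c) r

    ≤1+ρ : ∀ {c r} → r ≤ suc (ρ c r)
    ≤1+ρ {c} {r} = subst (_≤ suc (ρ c r)) (ρ-involutive {c} {r}) (ρ≤1+ {c} {ρ c r})

    ≤ρ : ∀ {c r} → r ≢ suc i → r ≤ ρ c r
    ≤ρ {c} {r} r≢1+i with r ≟ i | region c
    ... | no r≢i   | _              = ≤-reflexive (sym (ρ-other {c} r≢i r≢1+i))
    ... | yes _    | left c≤a       = ≤-reflexive (sym (ρ-left c≤a))
    ... | yes _    | right k<c      = ≤-reflexive (sym (ρ-right k<c))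
    ... | yes refl | window a<c c≤k = subst (r ≤_) (sym (ρ-window-i a<c c≤k)) (n≤1+n r)

    ρ-degenerate : k ≡ a → ∀ {c r} → ρ c r ≡ r
    ρ-degenerate k≡a {c} with region c
    ... | left c≤a       = ρ-left c≤a
    ... | right k<c      = ρ-right k<c
    ... | window a<c c≤k = ⊥-elim (<⇒≱ a<c (subst (c ≤_) k≡a c≤k))

    -- π c exchanges the values i, i+1 in the columns c > α_i and ρ c the rows i, i+1 in the columns
    -- α_i < c ≤ k, so T is T₀ of U when k = α_i and T_k of U otherwise.
    Exchanged : Filling → Filling → Set
    Exchanged T U = ∀ r c → T r c ≡ Maybe.map (π c) (U (ρ c r) c)

    Exchanged-sym : ∀ {T U} → Exchanged T U → Exchanged U T
    Exchanged-sym {T} {U} T~U r c = begin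
      U r c                            ≡⟨ map-involutive (λ v → π-involutive {c} {v}) (U r c) ⟨
      πc (πc (U r c))                  ≡⟨ cong (λ s → πc (πc (U s c))) (ρ-involutive {c} {r}) ⟨
      πc (πc (U (ρ c (ρ c r)) c))      ≡⟨ cong πc (T~U (ρ c r) c) ⟨
      πc (T (ρ c r) c)                 ∎
      where
      open ≡-Reasoning
      πc = Maybe.map (π c)

    exchanged-just : ∀ {T U s c w r v} → Exchanged T U →
                     U s c ≡ just w → ρ c s ≡ r → π c w ≡ v → T r c ≡ just v
    exchanged-just {T} {U} {s} {c} T~U e refl refl rewrite T~U (ρ c s) c | ρ-involutive {c} {s} | e = refl

    exchanged-nothing : ∀ {T U s c r} → Exchanged T U → U s c ≡ nothing → ρ c s ≡ r → T r c ≡ nothing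
    exchanged-nothing {T} {U} {s} {c} T~U e refl rewrite T~U (ρ c s) c | ρ-involutive {c} {s} | e = refl

    Tk-exchange : ∀ W r c → Tk α i W k r c ≡ Maybe.map (π c) (W (ρ c r) c)
    Tk-exchange W r c = trans (Tk-at-ρ (inWindow c)) (T0-exchange W (ρ c r) c)
      where
      Tk-at-ρ : ∀ b → (if b then (if r ≡ᵇ i then T0 α i W (suc i) c else if r ≡ᵇ suc i then T0 α i W i c
                                 else T0 α i W r c)
                       else T0 α i W r c) ≡ T0 α i W (swapIf i b r) c
      Tk-at-ρ true with r ≡ᵇ i | r ≡ᵇ suc i
      ... | true  | _     = refl
      ... | false | true  = refl
      ... | false | false = refl
      Tk-at-ρ false = refl

    -- What carries over uniformly from a Kohnert tableau S to an exchanged T: condition (i), the rows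
    -- above i+1, the basic block below row i+1 and left of column α_i, and (iv) left of column α_i.
    module Transfer (A B : List ℕ) (T S : Filling) (T~S : Exchanged T S)
      (A⇒B : ∀ {c v} → c ≤ part A v → c ≤ part B (π c v))
      (B⇒A : ∀ {c v} → c ≤ part B (π c v) → c ≤ part A v)
      (a≤B-upto : ∀ j → 1 ≤ j → j ≤ suc i → a ≤ part B j)
      (KS : KohnertTableau B S) where
      open KohnertTableau KS
      open KohnertFacts KS

      S~T : Exchanged S T
      S~T = Exchanged-sym {T} {S} T~S

      target-entry : ∀ {s c w r v} → S s c ≡ just w → ρ c s ≡ r → π c w ≡ v → T r c ≡ just v
      target-entry = exchanged-just {T} {S} T~S

      source-entry : ∀ {r c v s w} → T r c ≡ just v → ρ c r ≡ s → π c v ≡ w → S s c ≡ just w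
      source-entry {r} e refl refl = exchanged-just {S} {T} {s = r} S~T e refl refl

      target-row0-empty : ∀ c → T 0 c ≡ nothing
      target-row0-empty c = exchanged-nothing {T} {S} T~S (row0-empty c) (ρ-zero {c})

      target-entry-in-range : ∀ {r c v} → T r c ≡ just v → 1 ≤ c × c ≤ part A v
      target-entry-in-range e with entry-in-range (source-entry e refl refl)
      ... | 1≤c , c≤B = 1≤c , B⇒A c≤B

      source-basic-block : ∀ r c → 1 ≤ r → r ≤ suc i → 1 ≤ c → c ≤ a → S r c ≡ just r
      source-basic-block r c 1≤r r≤1+i 1≤c c≤a =
        basic-region r c 1≤r 1≤c (λ j 1≤j j≤r → ≤-trans c≤a (a≤B-upto j 1≤j (≤-trans j≤r r≤1+i)))

      target-basic-block : ∀ r c → 1 ≤ r → r ≤ suc i → 1 ≤ c → c ≤ a → T r c ≡ just r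
      target-basic-block r c 1≤r r≤1+i 1≤c c≤a =
        target-entry (source-basic-block r c 1≤r r≤1+i 1≤c c≤a) (ρ-left c≤a) (π-left c≤a)

      target-agrees-above : ∀ r c → suc i < r → T r c ≡ S r c
      target-agrees-above r c 1+i<r = trans (T~S r c)
        (trans (cong (λ t → Maybe.map (π c) (S t c)) (ρ-other {c} r≢i r≢1+i)) (unchanged (S r c) refl))
        where
        r≢i : r ≢ i
        r≢i = >⇒≢ (<-trans (n<1+n i) 1+i<r)
        r≢1+i : r ≢ suc i
        r≢1+i = >⇒≢ 1+i<r
        unchanged : ∀ m → S r c ≡ m → Maybe.map (π c) m ≡ m
        unchanged nothing  _ = refl
        unchanged (just v) e = cong just (π-other {c}
          (>⇒≢ (<-≤-trans (<-trans (n<1+n i) 1+i<r) (cond-ii r c v e)))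
          (>⇒≢ (<-≤-trans 1+i<r (cond-ii r c v e))))

      module _ (target-ii : ∀ r c v → T r c ≡ just v → r ≤ v) where

        target-cond-iv-left : ∀ x y c r r′ → T r c ≡ just x → T r′ c ≡ just y → x < y → r′ < r → c ≤ a →
                              ∃ λ r″ → r′ < r″ × T r″ (suc c) ≡ just x
        target-cond-iv-left x y c r r′ ex ey x<y r′<r c≤a with suc i <? r′
        ... | yes 1+i<r′ with cond-iv x y c r r′ (source-entry ex (ρ-left c≤a) (π-left c≤a))
                                           (source-entry ey (ρ-left c≤a) (π-left c≤a)) x<y r′<r
        ... | r″ , r′<r″ , e″ =
              r″ , r′<r″ , target-entry e″ (ρ-other {suc c} r″≢i r″≢1+i) (π-other {suc c} x≢i x≢1+i)
          where
          1+i<x : suc i < x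
          1+i<x = <-≤-trans (<-trans 1+i<r′ r′<r) (target-ii r c x ex)
          r″≢i : r″ ≢ i
          r″≢i = >⇒≢ (<-trans (n<1+n i) (<-trans 1+i<r′ r′<r″))
          r″≢1+i : r″ ≢ suc i
          r″≢1+i = >⇒≢ (<-trans 1+i<r′ r′<r″)
          x≢i : x ≢ i
          x≢i = >⇒≢ (<-trans (n<1+n i) 1+i<x)
          x≢1+i : x ≢ suc i
          x≢1+i = >⇒≢ 1+i<x
        target-cond-iv-left x y c r zero      ex ey x<y r′<r c≤a | no _ =
          ⊥-elim (just≢nothing (trans (sym ey) (target-row0-empty c)))
        -- in the basic block y = r′, so x < r′ < r ≤ x
        target-cond-iv-left x y c r (suc r₀) ex ey x<y r′<r c≤a | no 1+i≮r′ =
          ⊥-elim (<-irrefl refl (<-trans (<-≤-trans (subst (_< r) (sym y≡r′) r′<r) (target-ii r c x ex)) x<y))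
          where
          y≡r′ : y ≡ suc r₀
          y≡r′ = just-injective (trans (sym ey)
                   (target-basic-block (suc r₀) c (s≤s z≤n) (≮⇒≥ 1+i≮r′)
                                       (proj₁ (target-entry-in-range ey)) c≤a))

        target-QKT : (∀ v r c r′ c′ → T r c ≡ just v → T r′ c′ ≡ just v → c < c′ → r′ ≤ r) →
                     (∀ x y c r r′ → T r c ≡ just x → T r′ c ≡ just y → x < y → r′ < r → a < c →
                        ∃ λ r″ → r′ < r″ × T r″ (suc c) ≡ just x) →
                     QuasiYamanouchi S → QKT A T
        target-QKT target-iii target-iv-right QS = record
          { row0-empty  = target-row0-empty
          ; col0-empty  = λ r → trans (T~S r 0) (cong (Maybe.map (π 0)) (col0-empty (ρ 0 r)))
          ; entries-pos = positive
          ; cond-i-in   = cond-i-in′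
          ; cond-i-out  = λ v c out r e → out (target-entry-in-range e)
          ; cond-ii     = target-ii
          ; cond-iii    = target-iii
          ; cond-iv     = target-iv
          } , quasiYamanouchi-from-agreement (suc i) T S target-row0-empty
                (λ r 1≤r r≤1+i → target-basic-block r 1 1≤r r≤1+i ≤-refl 1≤a) target-agrees-above QS
          where
          positive : ∀ r c v → T r c ≡ just v → 1 ≤ v
          positive r c zero    e = ⊥-elim (uncurry <⇒≱ (target-entry-in-range e))
          positive r c (suc v) e = s≤s z≤n
          cond-i-in′ : ∀ v c → 1 ≤ c → c ≤ part A v →
                       ∃ λ r → T r c ≡ just v × (∀ r′ → T r′ c ≡ just v → r′ ≡ r)
          cond-i-in′ v c 1≤c c≤A with cond-i-in (π c v) c 1≤c (A⇒B c≤A)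
          ... | s , e , unique = ρ c s , target-entry e refl (π-involutive {c} {v}) ,
                λ r′ e′ → trans (sym (ρ-involutive {c} {r′}))
                                (cong (ρ c) (unique (ρ c r′) (source-entry e′ refl refl)))
          target-iv : ∀ x y c r r′ → T r c ≡ just x → T r′ c ≡ just y → x < y → r′ < r →
                      ∃ λ r″ → r′ < r″ × T r″ (suc c) ≡ just x
          target-iv x y c r r′ ex ey x<y r′<r with c ≤? a
          ... | yes c≤a = target-cond-iv-left x y c r r′ ex ey x<y r′<r c≤a
          ... | no c≰a  = target-iv-right x y c r r′ ex ey x<y r′<r (≰⇒> c≰a)

    module Forward (U : Filling) (KU : KohnertTableau β U) (QU : QuasiYamanouchi U)
      (T : Filling) (T~U : Exchanged T U)
      (U-row-i : ∀ c → 1 ≤ c → c ≤ k → U i c ≡ just i)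
      (U-gap : a < k → U (suc i) k ≡ nothing) where
      open KohnertTableau KU
      open KohnertFacts KU
      open Transfer α β T U T~U α-column⇒β-column β-column⇒α-column a≤β-upto KU

      T-row-suc-i : ∀ c → 1 ≤ c → c ≤ k → T (suc i) c ≡ just (suc i)
      T-row-suc-i c 1≤c c≤k with region c
      ... | left c≤a       = target-basic-block (suc i) c (s≤s z≤n) ≤-refl 1≤c c≤a
      ... | window a<c c≤k = target-entry (U-row-i c 1≤c c≤k) (ρ-window-i a<c c≤k) (π-right-i a<c)
      ... | right k<c      = ⊥-elim (<⇒≱ k<c c≤k)

      T-entry-i : ∀ {r c} → T r c ≡ just i → r ≡ i × c ≤ a
      T-entry-i {r} {c} e with c ≤? a
      ... | yes c≤a = entry-row-unique (source-entry e (ρ-left c≤a) (π-left c≤a))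
                        (source-basic-block i c 1≤i (n≤1+n i) (proj₁ (target-entry-in-range e)) c≤a) , c≤a
      ... | no c≰a with entry-in-range (source-entry e refl (π-right-i (≰⇒> c≰a)))
      ... | _ , c≤β = ⊥-elim (c≰a (subst (c ≤_) β-at-suc-i c≤β))

      T-entry-suc-i : ∀ {r c} → T r c ≡ just (suc i) →
                      (c ≤ k × r ≡ suc i) ⊎ (k < c × r ≤ i × U r c ≡ just i)
      T-entry-suc-i {r} {c} e with region c
      ... | left c≤a = inj₁ (≤-trans c≤a a≤k , entry-row-unique (source-entry e (ρ-left c≤a) (π-left c≤a))
              (source-basic-block (suc i) c (s≤s z≤n) ≤-refl (proj₁ (target-entry-in-range e)) c≤a))
      ... | window a<c c≤k =
            inj₁ (c≤k , trans (sym (ρ-involutive {c} {r})) (trans (cong (ρ c) ρr≡i) (ρ-window-i a<c c≤k)))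
        where ρr≡i = entry-row-unique (source-entry e refl (π-right-suc-i a<c))
                                      (U-row-i c (proj₁ (target-entry-in-range e)) c≤k)
      ... | right k<c = inj₂ (k<c , cond-ii r c i Ue , Ue)
        where Ue = source-entry e (ρ-right k<c) (π-right-suc-i (≤-<-trans a≤k k<c))

      T-entry-other : ∀ {r c v} → T r c ≡ just v → v ≢ i → v ≢ suc i →
                      (ρ c r ≡ r) ⊎ (r ≡ i × a < c × c ≤ k)
      T-entry-other {r} {c} {v} e v≢i v≢1+i with r ≟ i | r ≟ suc i | region c
      ... | _        | _        | left c≤a       = inj₁ (ρ-left c≤a)
      ... | _        | _        | right k<c      = inj₁ (ρ-right k<c)
      ... | yes refl | _        | window a<c c≤k = inj₂ (refl , a<c , c≤k)
      ... | no _     | yes refl | window a<c c≤k =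
            ⊥-elim (v≢1+i (just-injective (trans (sym e) (T-row-suc-i c (proj₁ (target-entry-in-range e)) c≤k))))
      ... | no r≢i   | no r≢1+i | window _ _     = inj₁ (ρ-other {c} r≢i r≢1+i)

      ≤ρ-at-other : ∀ {r c v} → T r c ≡ just v → v ≢ i → v ≢ suc i → r ≤ ρ c r
      ≤ρ-at-other {r} {c} e v≢i v≢1+i with T-entry-other e v≢i v≢1+i
      ... | inj₁ ρr≡r               = ≤-reflexive (sym ρr≡r)
      ... | inj₂ (refl , a<c , c≤k) = subst (r ≤_) (sym (ρ-window-i a<c c≤k)) (n≤1+n r)

      -- U has an empty cell at (i+1, k), which cond. (iii) of U cannot jump over
      U-row-suc-i-split : ∀ {c₁ c₂ v} → a < c₁ → c₁ ≤ k → k < c₂ →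
                          U (suc i) c₁ ≡ just v → U (suc i) c₂ ≡ just v → ⊥
      U-row-suc-i-split {c₁} {c₂} {v} a<c₁ c₁≤k k<c₂ e₁ e₂ with c₁ ≟ k
      ... | yes refl = just≢nothing (trans (sym e₁) (U-gap a<c₁))
      ... | no c₁≢k with cond-i-in v k (≤-trans 1≤a (<⇒≤ (<-≤-trans a<c₁ c₁≤k)))
                                       (≤-trans (<⇒≤ k<c₂) (proj₂ (entry-in-range e₂)))
      ... | r₀ , e₀ , _ =
            just≢nothing (trans (sym (subst (λ t → U t k ≡ just v) r₀≡1+i e₀)) (U-gap (<-≤-trans a<c₁ c₁≤k)))
        where
        r₀≡1+i : r₀ ≡ suc i
        r₀≡1+i = ≤-antisym (cond-iii v (suc i) c₁ r₀ k e₁ e₀ (≤∧≢⇒< c₁≤k c₁≢k))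
                           (cond-iii v r₀ k (suc i) c₂ e₀ e₂ k<c₂)

      T-ii : ∀ r c v → T r c ≡ just v → r ≤ v
      T-ii r c v e with c ≤? a
      ... | yes c≤a = subst₂ _≤_ (ρ-left c≤a) (π-left c≤a) (cond-ii _ _ _ (source-entry e refl refl))
      ... | no c≰a with v ≟ i | v ≟ suc i
      ... | yes refl | _ = ⊥-elim (c≰a (proj₂ (T-entry-i e)))
      ... | no _ | yes refl = ≤-trans (≤1+ρ {c} {r})
              (s≤s (subst (ρ c r ≤_) (π-right-suc-i (≰⇒> c≰a)) (cond-ii _ _ _ (source-entry e refl refl))))
      ... | no v≢i | no v≢1+i = ≤-trans (≤ρ-at-other e v≢i v≢1+i)
              (subst (ρ c r ≤_) (π-other {c} v≢i v≢1+i) (cond-ii _ _ _ (source-entry e refl refl)))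

      T-iii : ∀ v r₁ c₁ r₂ c₂ → T r₁ c₁ ≡ just v → T r₂ c₂ ≡ just v → c₁ < c₂ → r₂ ≤ r₁
      T-iii v r₁ c₁ r₂ c₂ e₁ e₂ c₁<c₂ with v ≟ i | v ≟ suc i
      ... | yes refl | _ = ≤-reflexive (trans (proj₁ (T-entry-i e₂)) (sym (proj₁ (T-entry-i e₁))))
      ... | no _ | yes refl with T-entry-suc-i e₁ | T-entry-suc-i e₂
      ... | inj₁ (_ , r₁≡) | inj₁ (_ , r₂≡)            = ≤-reflexive (trans r₂≡ (sym r₁≡))
      ... | inj₁ (_ , refl) | inj₂ (_ , r₂≤i , _)      = m≤n⇒m≤1+n r₂≤i
      ... | inj₂ (k<c₁ , _) | inj₁ (c₂≤k , _)          = ⊥-elim (<⇒≱ (<-trans k<c₁ c₁<c₂) c₂≤k)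
      ... | inj₂ (_ , _ , Ue₁) | inj₂ (_ , _ , Ue₂)    = cond-iii i r₁ c₁ r₂ c₂ Ue₁ Ue₂ c₁<c₂
      T-iii v r₁ c₁ r₂ c₂ e₁ e₂ c₁<c₂ | no v≢i | no v≢1+i = from-U (T-entry-other e₁ v≢i v≢1+i)
        where
        Ue₁ = source-entry e₁ refl (π-other {c₁} v≢i v≢1+i)
        Ue₂ = source-entry e₂ refl (π-other {c₂} v≢i v≢1+i)
        ρ-rows : ρ c₂ r₂ ≤ ρ c₁ r₁
        ρ-rows = cond-iii v _ c₁ _ c₂ Ue₁ Ue₂ c₁<c₂
        from-U : (ρ c₁ r₁ ≡ r₁) ⊎ (r₁ ≡ i × a < c₁ × c₁ ≤ k) → r₂ ≤ r₁
        from-U (inj₁ ρr₁≡r₁) = ≤-trans (≤ρ-at-other e₂ v≢i v≢1+i) (subst (ρ c₂ r₂ ≤_) ρr₁≡r₁ ρ-rows)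
        from-U (inj₂ (refl , a<c₁ , c₁≤k)) with T-entry-other e₂ v≢i v≢1+i
        ... | inj₂ (refl , _) = ≤-refl
        ... | inj₁ ρr₂≡r₂ with r₂ ≟ suc i
        ... | no r₂≢1+i = ≤-pred (≤∧≢⇒< (subst₂ _≤_ ρr₂≡r₂ (ρ-window-i a<c₁ c₁≤k) ρ-rows) r₂≢1+i)
        ... | yes refl with region c₂
        ... | left c₂≤a       = ⊥-elim (<⇒≱ (<-trans a<c₁ c₁<c₂) c₂≤a)
        ... | window a<c₂ c₂≤k = ⊥-elim (n≢1+n (trans (sym (ρ-window-suc-i a<c₂ c₂≤k)) ρr₂≡r₂))
        ... | right k<c₂      = ⊥-elim (U-row-suc-i-split a<c₁ c₁≤k k<c₂
                                  (subst (λ t → U t c₁ ≡ just v) (ρ-window-i a<c₁ c₁≤k) Ue₁)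
                                  (subst (λ t → U t c₂ ≡ just v) ρr₂≡r₂ Ue₂))

      module _ {x y c r r′} (ex : T r c ≡ just x) (ey : T r′ c ≡ just y) (x<y : x < y) (r′<r : r′ < r)
               (a<c : a < c) (x≢i : x ≢ i) (y≢i : y ≢ i) where

        1≤c : 1 ≤ c
        1≤c = proj₁ (target-entry-in-range ex)

        r′-not-in-row-suc-i : r′ ≡ suc i → c ≤ k → ⊥
        r′-not-in-row-suc-i refl c≤k =
          <-irrefl refl (<-trans (<-≤-trans r′<r (T-ii r c x ex)) (<-≤-trans x<y (≤-reflexive y≡1+i)))
          where y≡1+i = just-injective (trans (sym ey) (T-row-suc-i c 1≤c c≤k))

        r′≤ρr′ : r′ ≤ ρ c r′
        r′≤ρr′ with r′ ≟ suc i | region c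
        ... | no r′≢1+i | _              = ≤ρ {c} r′≢1+i
        ... | yes _     | left c≤a       = ⊥-elim (<⇒≱ a<c c≤a)
        ... | yes r′≡   | window _ c≤k   = ⊥-elim (r′-not-in-row-suc-i r′≡ c≤k)
        ... | yes _     | right k<c      = ≤-reflexive (sym (ρ-right k<c))

        ρ-keeps-order : ¬ (r ≡ suc i × r′ ≡ i × c ≤ k) → ρ c r′ < ρ c r
        ρ-keeps-order not-pair with region c | r′ ≟ i | r ≟ suc i | r′ ≟ suc i
        ... | left c≤a       | _        | _         | _ = ⊥-elim (<⇒≱ a<c c≤a)
        ... | right k<c      | _        | _         | _ = subst₂ _<_ (sym (ρ-right k<c)) (sym (ρ-right k<c)) r′<r
        ... | window _ c≤k   | yes refl | yes r≡    | _ = ⊥-elim (not-pair (r≡ , refl , c≤k))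
        ... | window a<c c≤k | yes refl | no r≢1+i  | _ =
              subst₂ _<_ (sym (ρ-window-i a<c c≤k)) (sym (ρ-other {c} (>⇒≢ r′<r) r≢1+i))
                         (≤∧≢⇒< r′<r (≢-sym r≢1+i))
        ... | window _ c≤k   | no _     | _         | yes r′≡ = ⊥-elim (r′-not-in-row-suc-i r′≡ c≤k)
        ... | window a<c c≤k | no r′≢i  | yes refl  | no r′≢1+i =
              subst₂ _<_ (sym (ρ-other {c} r′≢i r′≢1+i)) (sym (ρ-window-suc-i a<c c≤k))
                         (≤∧≢⇒< (≤-pred r′<r) r′≢i)
        ... | window _ _     | no r′≢i  | no r≢1+i  | no r′≢1+i =
              subst (_< ρ c r) (sym (ρ-other {c} r′≢i r′≢1+i)) (<-≤-trans r′<r (≤ρ {c} r≢1+i))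

        below-in-next-column : ∀ {s} → ρ c r′ < s → r′ < ρ (suc c) s
        below-in-next-column {s} ρr′<s with s ≟ suc i
        ... | no s≢1+i = <-≤-trans (≤-<-trans r′≤ρr′ ρr′<s) (≤ρ {suc c} s≢1+i)
        ... | yes refl with region (suc c)
        ... | left 1+c≤a = ⊥-elim (<⇒≱ a<c (≤-trans (n≤1+n c) 1+c≤a))
        ... | right k<1+c = subst (r′ <_) (sym (ρ-right k<1+c)) (≤-<-trans r′≤ρr′ ρr′<s)
        ... | window a<1+c 1+c≤k with r′ ≟ i | r′ ≟ suc i
        ... | yes refl | _       =
              ⊥-elim (<-irrefl refl (subst (_< suc i) (ρ-window-i a<c (≤-trans (n≤1+n c) 1+c≤k)) ρr′<s))
        ... | no _     | yes r′≡ = ⊥-elim (r′-not-in-row-suc-i r′≡ (≤-trans (n≤1+n c) 1+c≤k))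
        ... | no r′≢i  | no r′≢1+i = subst (r′ <_) (sym (ρ-window-suc-i a<1+c 1+c≤k))
                                       (≤∧≢⇒< (≤-pred (subst (_< suc i) (ρ-other {c} r′≢i r′≢1+i) ρr′<s)) r′≢i)

        iv-through-U : ¬ (r ≡ suc i × r′ ≡ i × c ≤ k) → ∃ λ r″ → r′ < r″ × T r″ (suc c) ≡ just x
        iv-through-U not-pair
          with cond-iv (π c x) (π c y) c (ρ c r) (ρ c r′) (source-entry ex refl refl) (source-entry ey refl refl)
                       (π-<-avoiding-i a<c x≢i y≢i x<y) (ρ-keeps-order not-pair)
        ... | s , ρr′<s , es = ρ (suc c) s , below-in-next-column ρr′<s ,
                               target-entry es refl (trans (π-right-const (m<n⇒m<1+n a<c) a<c) (π-involutive {c} {x}))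

        -- x sits at (i+1, c) and y at (i, c) of the window; the gap of U at (i+1, k) forces c < k
        iv-window-pair : r ≡ suc i → r′ ≡ i → c ≤ k → ∃ λ r″ → r′ < r″ × T r″ (suc c) ≡ just x
        iv-window-pair refl refl c≤k with c ≟ k
        ... | yes refl = ⊥-elim (just≢nothing (trans (sym ey)
                           (exchanged-nothing {T} {U} T~U (U-gap a<c) (ρ-window-suc-i a<c c≤k))))
        ... | no c≢k = suc i , n<1+n i ,
              subst (λ t → T (suc i) (suc c) ≡ just t) x≡1+i
                    (T-row-suc-i (suc c) (s≤s z≤n) (≤∧≢⇒< c≤k c≢k))
          where x≡1+i = just-injective (trans (sym (T-row-suc-i c 1≤c c≤k)) ex)

        iv-avoiding-i : ∃ λ r″ → r′ < r″ × T r″ (suc c) ≡ just x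
        iv-avoiding-i with r ≟ suc i | r′ ≟ i | c ≤? k
        ... | yes r≡ | yes r′≡ | yes c≤k = iv-window-pair r≡ r′≡ c≤k
        ... | no r≢    | _        | _      = iv-through-U (λ (r≡ , _ , _) → r≢ r≡)
        ... | yes _    | no r′≢   | _      = iv-through-U (λ (_ , r′≡ , _) → r′≢ r′≡)
        ... | yes _    | yes _    | no c≰k = iv-through-U (λ (_ , _ , c≤k) → c≰k c≤k)

      T-iv-right : ∀ x y c r r′ → T r c ≡ just x → T r′ c ≡ just y → x < y → r′ < r → a < c →
                   ∃ λ r″ → r′ < r″ × T r″ (suc c) ≡ just x
      T-iv-right x y c r r′ ex ey x<y r′<r a<c with x ≟ i | y ≟ i
      ... | yes refl | _        = ⊥-elim (<⇒≱ a<c (proj₂ (T-entry-i ex)))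
      ... | no _     | yes refl = ⊥-elim (<⇒≱ a<c (proj₂ (T-entry-i ey)))
      ... | no x≢i   | no y≢i   = iv-avoiding-i ex ey x<y r′<r a<c x≢i y≢i

      T-QKT : QKT α T
      T-QKT = target-QKT T-ii T-iii T-iv-right QU

    module Backward (T : Filling) (KT : KohnertTableau α T) (QT : QuasiYamanouchi T)
      (U : Filling) (U~T : Exchanged U T)
      (T-row-suc-i : ∀ c → 1 ≤ c → c ≤ k → T (suc i) c ≡ just (suc i))
      (T-row-suc-i-ends : ∀ c → k < c → T (suc i) c ≢ just (suc i)) where
      open KohnertTableau KT
      open KohnertFacts KT
      open Transfer β α U T U~T (λ {c} {v} → β-column⇒α-column′ {c} {v})
                    (λ {c} {v} → α-column⇒β-column′ {c} {v}) a≤α-upto KT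

      -- an entry j at (i, k) would, by (iv) against the i+1 above it, put an i+1 in row i+1 right of k
      T-gap : a < k → T i k ≡ nothing
      T-gap a<k with T i k in e
      ... | nothing = refl
      ... | just j with j ≟ i | j ≟ suc i
      ... | yes refl | _       = ⊥-elim (<⇒≱ a<k (proj₂ (entry-in-range e)))
      ... | no _     | yes refl = ⊥-elim (n≢1+n (entry-row-unique e T-k))
        where T-k = T-row-suc-i k (≤-trans 1≤a (<⇒≤ a<k)) ≤-refl
      ... | no j≢i   | no j≢1+i
        with cond-iv (suc i) j k (suc i) i (T-row-suc-i k (≤-trans 1≤a (<⇒≤ a<k)) ≤-refl) e
                     (≤∧≢⇒< (≤∧≢⇒< (cond-ii i k j e) (≢-sym j≢i)) (≢-sym j≢1+i)) (n<1+n i)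
      ... | r″ , 1+i≤r″ , e″ =
            ⊥-elim (T-row-suc-i-ends (suc k) (n<1+n k) (subst (λ t → T t (suc k) ≡ just (suc i)) r″≡1+i e″))
        where r″≡1+i = ≤-antisym (cond-ii r″ (suc k) (suc i) e″) 1+i≤r″

      U-row-i : ∀ c → 1 ≤ c → c ≤ k → U i c ≡ just i
      U-row-i c 1≤c c≤k with region c
      ... | left c≤a       = target-basic-block i c 1≤i (n≤1+n i) 1≤c c≤a
      ... | window a<c c≤k = target-entry (T-row-suc-i c 1≤c c≤k) (ρ-window-suc-i a<c c≤k) (π-right-suc-i a<c)
      ... | right k<c      = ⊥-elim (<⇒≱ k<c c≤k)

      U-entry-i : ∀ {r c} → U r c ≡ just i → (c ≤ k × r ≡ i) ⊎ (k < c × r ≤ i × T r c ≡ just (suc i))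
      U-entry-i {r} {c} e with region c
      ... | left c≤a = inj₁ (≤-trans c≤a a≤k , entry-row-unique (source-entry e (ρ-left c≤a) (π-left c≤a))
              (source-basic-block i c 1≤i (n≤1+n i) (proj₁ (target-entry-in-range e)) c≤a))
      ... | window a<c c≤k =
            inj₁ (c≤k , trans (sym (ρ-involutive {c} {r})) (trans (cong (ρ c) ρr≡1+i) (ρ-window-suc-i a<c c≤k)))
        where ρr≡1+i = entry-row-unique (source-entry e refl (π-right-i a<c))
                                        (T-row-suc-i c (proj₁ (target-entry-in-range e)) c≤k)
      ... | right k<c = inj₂ (k<c , ≤-pred (≤∧≢⇒< (cond-ii r c (suc i) Te) r≢1+i) , Te)
        where
        Te = source-entry e (ρ-right k<c) (π-right-i (≤-<-trans a≤k k<c))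
        r≢1+i : r ≢ suc i
        r≢1+i refl = T-row-suc-i-ends c k<c Te

      U-entry-suc-i : ∀ {r c} → U r c ≡ just (suc i) → r ≡ suc i × c ≤ a
      U-entry-suc-i {r} {c} e with c ≤? a
      ... | yes c≤a = entry-row-unique (source-entry e (ρ-left c≤a) (π-left c≤a))
                        (source-basic-block (suc i) c (s≤s z≤n) ≤-refl (proj₁ (target-entry-in-range e)) c≤a)
                    , c≤a
      ... | no c≰a with entry-in-range (source-entry e refl (π-right-suc-i (≰⇒> c≰a)))
      ... | _ , c≤a = ⊥-elim (c≰a c≤a)

      U-entry-other : ∀ {r c v} → U r c ≡ just v → v ≢ i → v ≢ suc i →
                      (ρ c r ≡ r) ⊎ (r ≡ suc i × a < c × c ≤ k)
      U-entry-other {r} {c} {v} e v≢i v≢1+i with r ≟ i | r ≟ suc i | region c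
      ... | _        | _        | left c≤a       = inj₁ (ρ-left c≤a)
      ... | _        | _        | right k<c      = inj₁ (ρ-right k<c)
      ... | no _     | yes refl | window a<c c≤k = inj₂ (refl , a<c , c≤k)
      ... | yes refl | _        | window a<c c≤k =
            ⊥-elim (v≢i (just-injective (trans (sym e) (U-row-i c (proj₁ (target-entry-in-range e)) c≤k))))
      ... | no r≢i   | no r≢1+i | window _ _     = inj₁ (ρ-other {c} r≢i r≢1+i)

      U-ii : ∀ r c v → U r c ≡ just v → r ≤ v
      U-ii r c v e with v ≟ i | v ≟ suc i
      ... | yes refl | _ with U-entry-i e
      ... | inj₁ (_ , refl)      = ≤-refl
      ... | inj₂ (_ , r≤i , _)   = r≤i
      U-ii r c v e | no _ | yes refl = ≤-reflexive (proj₁ (U-entry-suc-i e))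
      U-ii r c v e | no v≢i | no v≢1+i with U-entry-other e v≢i v≢1+i
      ... | inj₁ ρr≡r = subst₂ _≤_ ρr≡r (π-other {c} v≢i v≢1+i) (cond-ii _ _ _ (source-entry e refl refl))
      ... | inj₂ (refl , a<c , c≤k) =
            ≤∧≢⇒< (subst₂ _≤_ (ρ-window-suc-i a<c c≤k) (π-other {c} v≢i v≢1+i)
                           (cond-ii _ _ _ (source-entry e refl refl)))
                  (≢-sym v≢i)

      U-iii : ∀ v r₁ c₁ r₂ c₂ → U r₁ c₁ ≡ just v → U r₂ c₂ ≡ just v → c₁ < c₂ → r₂ ≤ r₁
      U-iii v r₁ c₁ r₂ c₂ e₁ e₂ c₁<c₂ with v ≟ i | v ≟ suc i
      ... | yes refl | _ with U-entry-i e₁ | U-entry-i e₂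
      ... | inj₁ (_ , r₁≡) | inj₁ (_ , r₂≡)          = ≤-reflexive (trans r₂≡ (sym r₁≡))
      ... | inj₁ (_ , refl) | inj₂ (_ , r₂≤i , _)    = r₂≤i
      ... | inj₂ (k<c₁ , _) | inj₁ (c₂≤k , _)        = ⊥-elim (<⇒≱ (<-trans k<c₁ c₁<c₂) c₂≤k)
      ... | inj₂ (_ , _ , Te₁) | inj₂ (_ , _ , Te₂)  = cond-iii (suc i) r₁ c₁ r₂ c₂ Te₁ Te₂ c₁<c₂
      U-iii v r₁ c₁ r₂ c₂ e₁ e₂ c₁<c₂ | no _ | yes refl =
        ≤-reflexive (trans (proj₁ (U-entry-suc-i e₂)) (sym (proj₁ (U-entry-suc-i e₁))))
      U-iii v r₁ c₁ r₂ c₂ e₁ e₂ c₁<c₂ | no v≢i | no v≢1+i =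
        from-T (U-entry-other e₁ v≢i v≢1+i) (U-entry-other e₂ v≢i v≢1+i)
        where
        Te₁ = source-entry e₁ refl (π-other {c₁} v≢i v≢1+i)
        Te₂ = source-entry e₂ refl (π-other {c₂} v≢i v≢1+i)
        ρ-rows : ρ c₂ r₂ ≤ ρ c₁ r₁
        ρ-rows = cond-iii v _ c₁ _ c₂ Te₁ Te₂ c₁<c₂
        from-T : (ρ c₁ r₁ ≡ r₁) ⊎ (r₁ ≡ suc i × a < c₁ × c₁ ≤ k) →
                 (ρ c₂ r₂ ≡ r₂) ⊎ (r₂ ≡ suc i × a < c₂ × c₂ ≤ k) → r₂ ≤ r₁
        from-T (inj₁ ρr₁≡) (inj₁ ρr₂≡) = subst₂ _≤_ ρr₂≡ ρr₁≡ ρ-rows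
        from-T (inj₂ (refl , a<c₁ , c₁≤k)) (inj₁ ρr₂≡) =
          m≤n⇒m≤1+n (subst₂ _≤_ ρr₂≡ (ρ-window-suc-i a<c₁ c₁≤k) ρ-rows)
        from-T (inj₂ (refl , _ , _)) (inj₂ (refl , _ , _)) = ≤-refl
        from-T (inj₁ ρr₁≡) (inj₂ (refl , a<c₂ , c₂≤k)) with r₁ ≟ i
        ... | yes refl = ⊥-elim (v≢i (just-injective (trans (sym e₁)
                           (U-row-i c₁ (proj₁ (target-entry-in-range e₁)) (≤-trans (<⇒≤ c₁<c₂) c₂≤k)))))
        ... | no r₁≢i = ≤∧≢⇒< (subst₂ _≤_ (ρ-window-suc-i a<c₂ c₂≤k) ρr₁≡ ρ-rows) (≢-sym r₁≢i)

      module _ {x y c r r′} (ex : U r c ≡ just x) (ey : U r′ c ≡ just y) (x<y : x < y) (r′<r : r′ < r)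
               (a<c : a < c) (x≢1+i : x ≢ suc i) (y≢1+i : y ≢ suc i) where

        ρ-keeps-order : ρ c r′ < ρ c r
        ρ-keeps-order with region c | r′ ≟ i | r′ ≟ suc i | r ≟ suc i
        ... | left c≤a       | _        | _        | _ = ⊥-elim (<⇒≱ a<c c≤a)
        ... | right k<c      | _        | _        | _ = subst₂ _<_ (sym (ρ-right k<c)) (sym (ρ-right k<c)) r′<r
        ... | window a<c c≤k | yes refl | _        | yes refl =
              ⊥-elim (<⇒≱ (subst (x <_) y≡i x<y) (≤-trans (n≤1+n i) (U-ii r c x ex)))
          where y≡i = just-injective (trans (sym ey) (U-row-i c (proj₁ (target-entry-in-range ex)) c≤k))
        ... | window a<c c≤k | yes refl | _        | no r≢1+i =
              subst₂ _<_ (sym (ρ-window-i a<c c≤k)) (sym (ρ-other {c} (>⇒≢ r′<r) r≢1+i))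
                         (≤∧≢⇒< r′<r (≢-sym r≢1+i))
        ... | window a<c c≤k | no _     | yes refl | _ =
              subst₂ _<_ (sym (ρ-window-suc-i a<c c≤k))
                         (sym (ρ-other {c} (>⇒≢ (<-trans (n<1+n i) r′<r)) (>⇒≢ r′<r)))
                     (<-trans (n<1+n i) r′<r)
        ... | window a<c c≤k | no r′≢i  | no r′≢1+i | yes refl =
              subst₂ _<_ (sym (ρ-other {c} r′≢i r′≢1+i)) (sym (ρ-window-suc-i a<c c≤k))
                         (≤∧≢⇒< (≤-pred r′<r) r′≢i)
        ... | window _ _     | no r′≢i  | no r′≢1+i | no r≢1+i =
              subst (_< ρ c r) (sym (ρ-other {c} r′≢i r′≢1+i)) (<-≤-trans r′<r (≤ρ {c} r≢1+i))

        below-unless-suc-i : ∀ {s} → ρ c r′ < s → s ≢ suc i → r′ < s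
        below-unless-suc-i {s} ρr′<s s≢1+i with r′ ≟ suc i | c ≤? k
        ... | yes refl | yes c≤k = ≤∧≢⇒< (subst (_< s) (ρ-window-suc-i a<c c≤k) ρr′<s) (≢-sym s≢1+i)
        ... | yes refl | no c≰k  = subst (_< s) (ρ-right (≰⇒> c≰k)) ρr′<s
        ... | no r′≢1+i | _      = ≤-<-trans (≤ρ {c} r′≢1+i) ρr′<s

        below-in-next-column : ∀ {s} → ρ c r′ < s → T s (suc c) ≡ just (π c x) → r′ < ρ (suc c) s
        below-in-next-column {s} ρr′<s es with s ≟ suc i
        ... | no s≢1+i = <-≤-trans (below-unless-suc-i ρr′<s s≢1+i) (≤ρ {suc c} s≢1+i)
        ... | yes refl with region (suc c)
        ... | left 1+c≤a = ⊥-elim (<⇒≱ a<c (≤-trans (n≤1+n c) 1+c≤a))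
        ... | right k<1+c with r′ ≟ suc i | c ≤? k
        ...   | yes refl | yes c≤k = ⊥-elim (just≢nothing (trans (sym ey)
                  (exchanged-nothing {U} {T} U~T (subst (λ t → T i t ≡ nothing) (≤-antisym (≤-pred k<1+c) c≤k)
                    (T-gap (<-≤-trans a<c c≤k))) (ρ-window-i a<c c≤k))))
        ...   | yes refl | no c≰k  = ⊥-elim (<-irrefl refl (subst (_< suc i) (ρ-right (≰⇒> c≰k)) ρr′<s))
        ...   | no r′≢1+i | _      = subst (r′ <_) (sym (ρ-right k<1+c)) (≤-<-trans (≤ρ {c} r′≢1+i) ρr′<s)
        below-in-next-column ρr′<s es | yes refl | window a<1+c 1+c≤k with r′ ≟ i | r′ ≟ suc i
        ... | yes refl | _ =
              ⊥-elim (<-irrefl refl (subst (_< suc i) (ρ-window-i a<c (≤-trans (n≤1+n c) 1+c≤k)) ρr′<s))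
        ... | no _     | yes refl = ⊥-elim (<⇒≱ r′<r (≤-trans (subst (r ≤_) x≡i (U-ii r c x ex)) (n≤1+n i)))
          where
          x≡i : x ≡ i
          x≡i = trans (sym (π-involutive {c} {x}))
                  (trans (cong (π c) (just-injective (trans (sym es) (T-row-suc-i (suc c) (s≤s z≤n) 1+c≤k))))
                         (π-right-suc-i a<c))
        ... | no r′≢i  | no r′≢1+i = subst (r′ <_) (sym (ρ-window-suc-i a<1+c 1+c≤k))
                                       (≤∧≢⇒< (≤-pred (subst (_< suc i) (ρ-other {c} r′≢i r′≢1+i) ρr′<s)) r′≢i)

        iv-avoiding-suc-i : ∃ λ r″ → r′ < r″ × U r″ (suc c) ≡ just x
        iv-avoiding-suc-i
          with cond-iv (π c x) (π c y) c (ρ c r) (ρ c r′) (source-entry ex refl refl) (source-entry ey refl refl)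
                       (π-<-avoiding-suc-i a<c x≢1+i y≢1+i x<y) ρ-keeps-order
        ... | s , ρr′<s , es = ρ (suc c) s , below-in-next-column ρr′<s es ,
                               target-entry es refl (trans (π-right-const (m<n⇒m<1+n a<c) a<c) (π-involutive {c} {x}))

      U-iv-right : ∀ x y c r r′ → U r c ≡ just x → U r′ c ≡ just y → x < y → r′ < r → a < c →
                   ∃ λ r″ → r′ < r″ × U r″ (suc c) ≡ just x
      U-iv-right x y c r r′ ex ey x<y r′<r a<c with x ≟ suc i | y ≟ suc i
      ... | yes refl | _        = ⊥-elim (<⇒≱ a<c (proj₂ (U-entry-suc-i ex)))
      ... | no _     | yes refl = ⊥-elim (<⇒≱ a<c (proj₂ (U-entry-suc-i ey)))
      ... | no x≢1+i | no y≢1+i = iv-avoiding-suc-i ex ey x<y r′<r a<c x≢1+i y≢1+i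

      U-QKT : QKT β U
      U-QKT = target-QKT U-ii U-iii U-iv-right QT

-- Compositions with an inversion

module FirstAscent (α : List ℕ) (strong : Strong α) (i : ℕ) (1≤i : 1 ≤ i) (i<ℓ : suc i ≤ length α)
  (ascent : part α i < part α (suc i)) (first : ∀ j → 1 ≤ j → j < i → ¬ part α j < part α (suc j)) where

  β : List ℕ
  β = swapParts i α

  1≤a : 1 ≤ part α i
  1≤a = Strong⇒part-positive strong 1≤i (≤-trans (n≤1+n i) i<ℓ)

  open Exchange α β i 1≤i 1≤a ascent
    (weakly-decreasing⇒≤ α i (λ j 1≤j j<i → ≮⇒≥ (first j 1≤j j<i)))
    (part-swapParts-i α 1≤i i<ℓ) (part-swapParts-suc-i α 1≤i i<ℓ) (λ j → part-swapParts-other α j 1≤i)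

  S⊆QKT : ∀ {T} → (∃ λ T̂ → QKT β T̂ × InS α i T̂ T) → QKT α T
  S⊆QKT {T} (T̂ , (KT̂ , QT̂) , inj₁ T≐T0) =
    Forward.T-QKT T̂ KT̂ QT̂ T T~T̂ T̂-row-i λ a<a → ⊥-elim (<-irrefl refl a<a)
    where
    open Window a ≤-refl
    T~T̂ : Exchanged T T̂
    T~T̂ r c = trans (T≐T0 r c) (trans (T0-exchange T̂ r c)
                (cong (λ t → Maybe.map (π c) (T̂ t c)) (sym (ρ-degenerate refl {c} {r}))))
    T̂-row-i : ∀ c → 1 ≤ c → c ≤ a → T̂ i c ≡ just i
    T̂-row-i c 1≤c c≤a = KohnertFacts.basic-region KT̂ i c 1≤i 1≤c
                          (λ j 1≤j j≤i → ≤-trans c≤a (a≤β-upto j 1≤j (m≤n⇒m≤1+n j≤i)))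
  S⊆QKT {T} (T̂ , (KT̂ , QT̂) , inj₂ (k , a<k , _ , T0-gap , T0-i+1 , T≐Tk)) =
    Forward.T-QKT T̂ KT̂ QT̂ T (λ r c → trans (T≐Tk r c) (Tk-exchange T̂ r c)) T̂-row-i (λ _ → T̂-gap)
    where
    open Window k (<⇒≤ a<k)
    T̂-i-at-k : T̂ i k ≡ just i
    T̂-i-at-k with map-just⁻ (trans (sym (T0-exchange T̂ i k)) T0-i+1)
    ... | w , e , πw≡1+i = trans e (cong just (trans (sym (π-involutive {k} {w}))
                                                     (trans (cong (π k) πw≡1+i) (π-right-suc-i a<k))))
    T̂-row-i : ∀ c → 1 ≤ c → c ≤ k → T̂ i c ≡ just i
    T̂-row-i c = KohnertFacts.self-entry-leftward KT̂ T̂-i-at-k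
    T̂-gap : T̂ (suc i) k ≡ nothing
    T̂-gap = map-nothing⁻ (trans (sym (T0-exchange T̂ (suc i) k)) T0-gap)

  QKT⊆S : ∀ {T} → QKT α T → ∃ λ T̂ → QKT β T̂ × InS α i T̂ T
  QKT⊆S {T} (KT , QT) = T̂ , Backward.U-QKT T KT QT T̂ (λ r c → refl) T-row-suc-i T-row-suc-i-ends , T∈S
    where
    open KohnertTableau KT
    open KohnertFacts KT
    open LastSatisfying (λ c → ≡-dec _≟_ (T (suc i) c) (just (suc i)))

    -- k is the last column of the (i+1)-st row of T holding an entry i+1
    k : ℕ
    k = last b
    a≤k : a ≤ k
    a≤k = ≤last b a (<⇒≤ ascent) (basic-region (suc i) a (s≤s z≤n) 1≤a a≤α-upto)
    open Window k a≤k

    T-row-suc-i : ∀ c → 1 ≤ c → c ≤ k → T (suc i) c ≡ just (suc i)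
    T-row-suc-i c with last-zero-or-satisfies b
    ... | inj₁ k≡0 = λ 1≤c c≤k → ⊥-elim (<⇒≱ 1≤c (subst (c ≤_) k≡0 c≤k))
    ... | inj₂ Tk  = self-entry-leftward Tk
    T-row-suc-i-ends : ∀ c → k < c → T (suc i) c ≢ just (suc i)
    T-row-suc-i-ends c k<c with c ≤? b
    ... | yes c≤b = last-maximal b c k<c c≤b
    ... | no c≰b  = cond-i-out (suc i) c (c≰b ∘′ proj₂) (suc i)

    T̂ : Filling
    T̂ r c = Maybe.map (π c) (T (ρ c r) c)
    T~T̂ : Exchanged T T̂
    T~T̂ = Exchanged-sym {T̂} {T} (λ r c → refl)

    T∈S : InS α i T̂ T
    T∈S with k ≟ a
    ... | yes k≡a = inj₁ λ r c → trans (T~T̂ r c)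
                      (trans (cong (λ t → Maybe.map (π c) (T̂ t c)) (ρ-degenerate k≡a {c} {r}))
                             (sym (T0-exchange T̂ r c)))
    ... | no k≢a =
          inj₂ (k , a<k , last≤ b , T0-gap , T0-i+1 , λ r c → trans (T~T̂ r c) (sym (Tk-exchange T̂ r c)))
      where
      a<k : a < k
      a<k = ≤∧≢⇒< a≤k (≢-sym k≢a)
      open Backward T KT QT T̂ (λ r c → refl) T-row-suc-i T-row-suc-i-ends
      T0-gap : T0 α i T̂ (suc i) k ≡ nothing
      T0-gap = trans (T0-exchange T̂ (suc i) k) (cong (Maybe.map (π k))
                 (exchanged-nothing {T̂} {T} (λ r c → refl) (T-gap a<k) (ρ-window-i a<k ≤-refl)))
      T0-i+1 : T0 α i T̂ i k ≡ just (suc i)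
      T0-i+1 = trans (T0-exchange T̂ i k)
                 (trans (cong (Maybe.map (π k)) (U-row-i k (≤-trans 1≤a a≤k) ≤-refl)) (cong just (π-right-i a<k)))

  QKT⇔S : ∀ T → QKT α T ⇔ (∃ λ T̂ → QKT β T̂ × InS α i T̂ T)
  QKT⇔S T = mk⇔ QKT⊆S S⊆QKT

theorem4p4 : (α : List ℕ) → Strong α →
    (¬ HasInversion α → ∀ T → (QKT α T ⇔ (T ≐ basic α))) ×
    (HasInversion α → ∀ i → IsFirstAscent α i → ∀ T →
      (QKT α T ⇔ (∃ λ T̂ → QKT (swapParts i α) T̂ × InS α i T̂ T)))
theorem4p4 α strong =
  (λ no-inversion T → mk⇔ (NoInversion.Kohnert⇒≐basic α no-inversion ∘′ proj₁) (≐basic⇒QKT α)) ,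
  (λ _ i (1≤i , i<ℓ , ascent , first) → FirstAscent.QKT⇔S α strong i 1≤i i<ℓ ascent first)
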